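{- Let $G=(V,E_G)$ be a bipartite graph and let $H=(V,E_H)$ be an unweighted edge-degree constrained subgraph of $G$ with parameters $\beta$ and $\beta^-=\beta(1-\lambda)$ for some $0<\lambda<1$. Then there exist disjoint sets of vertices $S,T$ such that: (1) $|T|=\mu(H)$; (2) $|S|=2(\mu(G)-\mu(H))$; (3) every edge of $H$ incident to a vertex of $S$ has its other endpoint in $T$; (4) $\sum_{s\in S} d_H(s) \ge |S|\cdot\frac{\beta(1-\lambda)}{2}$, i.e. the average of $d_H(s)$ over $s\in S$ is at least $\frac{\beta(1-\lambda)}{2}$.
   Context: $\mu(\cdot)$ is the maximum matching size; $d_H(v)$ is the degree of $v$ in $H$. An edge of $G$ is used if it lies in $H$, unused otherwise. An unweighted edge-degree constrained subgraph with parameters $(G,\beta,\beta^-)$ is $H\subseteq E_G$ such that (P1) every used edge $(u,v)$ has $d_H(u)+d_H(v)\le\beta$ and (P2) every unused edge $(u,v)$ has $d_H(u)+d_H(v)\ge\beta^-$.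
   Formalization: The parameters β and λ of the edge-degree constrained subgraph take rational values. -}

module Defs where

open import Data.Bool using (Bool; true; false; if_then_else_; T)
open import Data.Nat using (ℕ; _+_; _*_)
open import Data.Integer using (+_)
open import Data.Fin using (Fin)
open import Data.Fin.Subset using (Subset; _∈_; _∉_; ∣_∣)
open import Data.Vec using (lookup)
open import Data.Nat.ListAction using (sum)
open import Data.List using (List; []; _∷_; map; length; concatMap; allFin)
open import Data.List.Relation.Unary.All using (All)
open import Data.List.Relation.Unary.Unique.Propositional using (Unique)
open import Data.Product using (_×_; _,_; Σ; ∃)
open import Relation.Binary.PropositionalEquality using (_≡_; _≢_)
open import Relation.Nullary using (¬_)
open import Data.Rational using (ℚ; _/_; _≤_)

Graph : ℕ → Set
Graph n = Fin n → Fin n → Bool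

record IsSimpleGraph {n : ℕ} (E : Graph n) : Set where
  field
    symmetric   : ∀ u v → E u v ≡ E v u
    irreflexive : ∀ v → ¬ T (E v v)

_⊆E_ : {n : ℕ} → Graph n → Graph n → Set
H ⊆E G = ∀ u v → T (H u v) → T (G u v)

IsBipartite : {n : ℕ} → Graph n → Set
IsBipartite {n} G = Σ (Fin n → Bool) λ c → ∀ u v → T (G u v) → c u ≢ c v

deg : {n : ℕ} → Graph n → Fin n → ℕ
deg {n} E v = sum (map (λ u → if E v u then 1 else 0) (allFin n))

endpoints : {n : ℕ} → List (Fin n × Fin n) → List (Fin n)
endpoints = concatMap (λ { (u , v) → u ∷ v ∷ [] })

IsMatching : {n : ℕ} → Graph n → List (Fin n × Fin n) → Set
IsMatching E M = All (λ { (u , v) → T (E u v) }) M × Unique (endpoints M)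

IsMaxMatchingSize : {n : ℕ} → Graph n → ℕ → Set
IsMaxMatchingSize {n} E k =
  (Σ (List (Fin n × Fin n)) λ M → IsMatching E M × length M ≡ k)
  × (∀ M → IsMatching E M → length M Data.Nat.≤ k)

ℕtoℚ : ℕ → ℚ
ℕtoℚ k = (+ k) / 1

IsEDCS : {n : ℕ} → Graph n → Graph n → ℚ → ℚ → Set
IsEDCS G H β β⁻ =
  H ⊆E G
  × (∀ u v → T (H u v) → ℕtoℚ (deg H u + deg H v) ≤ β)
  × (∀ u v → T (G u v) → ¬ T (H u v) → β⁻ ≤ ℕtoℚ (deg H u + deg H v))

Disjoint : {n : ℕ} → Subset n → Subset n → Set
Disjoint {n} S T' = ∀ (v : Fin n) → v ∈ S → v ∉ T'

degSum : {n : ℕ} → Graph n → Subset n → ℕ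
degSum {n} E S = sum (map (λ v → if lookup S v then deg E v else 0) (allFin n))

module Submission where

-- Kőnig's theorem gives a vertex cover C of H with |C| ≤ μ(H).  Each vertex of C meets at most one
-- edge of a maximum matching of G, so at least μ(G) − μ(H) of its edges avoid C; S is the set of
-- endpoints of μ(G) − μ(H) of them.  These edges are unused, since C covers H, so (P2) bounds the
-- degree sum of each from below by β(1 − λ), which gives (4).  Every H-edge leaving S ends in C,
-- and T is C enlarged to μ(H) vertices outside S.

open import Defs

module Lists where

  open import Data.List using (List; _∷_; length)
  open import Data.List.Properties using (length-removeAt′)
  open import Data.List.Membership.Propositional using (_∈_)
  open import Data.List.Relation.Unary.Any using (here; there; _─_; index)
  open import Data.List.Relation.Unary.Unique.Propositional using (Unique; []; _∷_)
  open import Data.List.Relation.Binary.Sublist.Propositional using (_⊆_; []; _∷_; _∷ʳ_)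
  open import Data.List.Relation.Binary.Sublist.Propositional.Properties using (All-resp-⊆)
  open import Data.List.Relation.Binary.Permutation.Propositional
    using (_↭_; ↭-refl; ↭-prep; ↭-swap; ↭-trans; ↭⇒↭ₛ)
  import Data.List.Relation.Binary.Permutation.Setoid.Properties as Permutationₛ
  open import Data.Nat using (suc)
  open import Relation.Binary.PropositionalEquality using (_≡_; _≢_; refl; setoid)
  open import Relation.Nullary using (contradiction)

  private variable
    A : Set
    x y : A
    xs ys : List A

  Unique-⊆ : xs ⊆ ys → Unique ys → Unique xs
  Unique-⊆ []         _             = []
  Unique-⊆ (_ ∷ʳ τ)   (_ ∷ ys!)     = Unique-⊆ τ ys!
  Unique-⊆ (refl ∷ τ) (y∉ys ∷ ys!)  = All-resp-⊆ τ y∉ys ∷ Unique-⊆ τ ys!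

  Unique-↭ : ∀ {A : Set} {xs ys : List A} → xs ↭ ys → Unique xs → Unique ys
  Unique-↭ {A = A} σ = Permutationₛ.Unique-resp-↭ (setoid A) (↭⇒↭ₛ σ)

  ↭-─ : (x∈xs : x ∈ xs) → xs ↭ x ∷ (xs ─ x∈xs)
  ↭-─ (here refl)                 = ↭-refl
  ↭-─ {x = x} {y ∷ _} (there x∈xs) = ↭-trans (↭-prep y (↭-─ x∈xs)) (↭-swap y x ↭-refl)

  ∈-─⁺ : (x∈xs : x ∈ xs) → y ∈ xs → y ≢ x → y ∈ (xs ─ x∈xs)
  ∈-─⁺ (here refl)  (here refl)  y≢x = contradiction refl y≢x
  ∈-─⁺ (here refl)  (there y∈xs) _   = y∈xs
  ∈-─⁺ (there x∈xs) (here refl)  _   = here refl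
  ∈-─⁺ (there x∈xs) (there y∈xs) y≢x = there (∈-─⁺ x∈xs y∈xs y≢x)

  length-─ : (x∈xs : x ∈ xs) → length xs ≡ suc (length (xs ─ x∈xs))
  length-─ {xs = xs} x∈xs = length-removeAt′ xs (index x∈xs)

module Subsets where

  open import Data.Bool using (Bool; true; false; if_then_else_; _∧_; _∨_)
  open import Data.Fin using (Fin; zero; suc)
  open import Data.Fin.Subset using (Subset; _∈_; _∉_; _⊆_; ∣_∣; ⊥; ⁅_⁆; _∪_; _∩_; inside; outside)
  open import Data.Fin.Subset.Properties
    using (∉⊥; x∈p∪q⁻; x∈p∪q⁺; x∈⁅x⁆; x∈⁅y⁆⇒x≡y; x∈p∩q⁻; Empty-unique; p⊆q⇒∣p∣≤∣q∣; ∣p∣≤n;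
           drop-∷-⊆; out⊆; in⊆in)
  open import Data.List using (List; []; _∷_; map; length; allFin; foldr; tabulate)
  open import Data.List.Properties using (map-tabulate)
  open import Data.List.Membership.Propositional using () renaming (_∈_ to _∈ₗ_)
  open import Data.List.Relation.Unary.All as All using (All)
  open import Data.List.Relation.Unary.All.Properties using (All¬⇒¬Any)
  open import Data.List.Relation.Unary.Any using (here; there)
  open import Data.List.Relation.Unary.Unique.Propositional using (Unique; []; _∷_)
  open import Data.Nat using (ℕ; zero; suc; _+_; _≤_; s≤s; _≤?_)
  open import Data.Nat.ListAction using (sum)
  open import Data.Nat.Properties
    using (+-commutativeSemigroup; +-comm; +-identityʳ; m≤m+n; +-monoʳ-≤; ≤-trans; ≤-reflexive; ≤-antisym;
           n≤0⇒n≡0; ≰⇒>)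
  open import Data.Product using (Σ; _×_; _,_)
  open import Data.Sum using (inj₁; inj₂)
  open import Data.Vec using ([]; _∷_; lookup) renaming (here to [zero]=)
  open import Function using (id; _∘_)
  open import Relation.Binary.PropositionalEquality
    using (_≡_; refl; sym; trans; cong; cong₂; subst; subst₂; module ≡-Reasoning)
  open import Relation.Nullary using (yes; no; contradiction)
  open import Algebra.Properties.CommutativeSemigroup +-commutativeSemigroup using (interchange)

  private variable
    n : ℕ

  sumOver : Subset n → (Fin n → ℕ) → ℕ
  sumOver []      f = 0
  sumOver (s ∷ p) f = (if s then f zero else 0) + sumOver p (f ∘ suc)

  sum-allFin≡sumOver : (p : Subset n) (f : Fin n → ℕ) →
    sum (map (λ v → if lookup p v then f v else 0) (allFin n)) ≡ sumOver p f
  sum-allFin≡sumOver []      f = refl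
  sum-allFin≡sumOver {suc n} (s ∷ p) f = cong ((if s then f zero else 0) +_) (begin
    sum (map g (tabulate suc))      ≡⟨ cong sum (map-tabulate suc g) ⟩
    sum (tabulate (g ∘ suc))        ≡⟨ cong sum (sym (map-tabulate id (g ∘ suc))) ⟩
    sum (map (g ∘ suc) (allFin n))  ≡⟨ sum-allFin≡sumOver p (f ∘ suc) ⟩
    sumOver p (f ∘ suc)             ∎)
    where
    open ≡-Reasoning
    g : Fin (suc n) → ℕ
    g v = if lookup (s ∷ p) v then f v else 0

  degSum≡sumOver : (E : Graph n) (p : Subset n) → degSum E p ≡ sumOver p (deg E)
  degSum≡sumOver E p = sum-allFin≡sumOver p (deg E)

  ∣p∣≡sumOver : (p : Subset n) → ∣ p ∣ ≡ sumOver p (λ _ → 1)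
  ∣p∣≡sumOver []            = refl
  ∣p∣≡sumOver (inside ∷ p)  = cong suc (∣p∣≡sumOver p)
  ∣p∣≡sumOver (outside ∷ p) = ∣p∣≡sumOver p

  sumOver-⊥ : (f : Fin n → ℕ) → sumOver ⊥ f ≡ 0
  sumOver-⊥ {zero}  f = refl
  sumOver-⊥ {suc n} f = sumOver-⊥ (f ∘ suc)

  sumOver-⁅⁆ : (x : Fin n) (f : Fin n → ℕ) → sumOver ⁅ x ⁆ f ≡ f x
  sumOver-⁅⁆ zero    f = trans (cong (f zero +_) (sumOver-⊥ (f ∘ suc))) (+-identityʳ (f zero))
  sumOver-⁅⁆ (suc x) f = sumOver-⁅⁆ x (f ∘ suc)

  sumOver-∪+∩ : (p q : Subset n) (f : Fin n → ℕ) →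
    sumOver (p ∪ q) f + sumOver (p ∩ q) f ≡ sumOver p f + sumOver q f
  sumOver-∪+∩ []      []      f = refl
  sumOver-∪+∩ (s ∷ p) (t ∷ q) f = begin
    (w (s ∨ t) + sumOver (p ∪ q) f′) + (w (s ∧ t) + sumOver (p ∩ q) f′)
      ≡⟨ interchange (w (s ∨ t)) _ (w (s ∧ t)) _ ⟩
    (w (s ∨ t) + w (s ∧ t)) + (sumOver (p ∪ q) f′ + sumOver (p ∩ q) f′)
      ≡⟨ cong₂ _+_ (heads s t) (sumOver-∪+∩ p q f′) ⟩
    (w s + w t) + (sumOver p f′ + sumOver q f′)
      ≡⟨ interchange (w s) (w t) _ _ ⟩
    (w s + sumOver p f′) + (w t + sumOver q f′) ∎
    where
    open ≡-Reasoning
    f′ = f ∘ suc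
    w : Bool → ℕ
    w s = if s then f zero else 0
    heads : ∀ s t → w (s ∨ t) + w (s ∧ t) ≡ w s + w t
    heads true  true  = refl
    heads true  false = refl
    heads false true  = +-comm (f zero) 0
    heads false false = refl

  sumOver-⁅x⁆∪p≤ : (x : Fin n) (p : Subset n) (f : Fin n → ℕ) → sumOver (⁅ x ⁆ ∪ p) f ≤ f x + sumOver p f
  sumOver-⁅x⁆∪p≤ x p f = subst (sumOver (⁅ x ⁆ ∪ p) f ≤_)
    (trans (sumOver-∪+∩ ⁅ x ⁆ p f) (cong (_+ sumOver p f) (sumOver-⁅⁆ x f)))
    (m≤m+n _ _)

  sumOver-⁅x⁆∪p : ∀ {x : Fin n} {p} (f : Fin n → ℕ) → x ∉ p → sumOver (⁅ x ⁆ ∪ p) f ≡ f x + sumOver p f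
  sumOver-⁅x⁆∪p {x = x} {p} f x∉p = begin
    sumOver (⁅ x ⁆ ∪ p) f                            ≡⟨ sym (+-identityʳ _) ⟩
    sumOver (⁅ x ⁆ ∪ p) f + 0                        ≡⟨ cong (sumOver (⁅ x ⁆ ∪ p) f +_) (sym ∩-vanishes) ⟩
    sumOver (⁅ x ⁆ ∪ p) f + sumOver (⁅ x ⁆ ∩ p) f    ≡⟨ sumOver-∪+∩ ⁅ x ⁆ p f ⟩
    sumOver ⁅ x ⁆ f + sumOver p f                    ≡⟨ cong (_+ sumOver p f) (sumOver-⁅⁆ x f) ⟩
    f x + sumOver p f                                ∎
    where
    open ≡-Reasoning
    ⁅x⁆∩p≡⊥ : ⁅ x ⁆ ∩ p ≡ ⊥
    ⁅x⁆∩p≡⊥ = Empty-unique λ (y , y∈⁅x⁆∩p) →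
      let y∈⁅x⁆ , y∈p = x∈p∩q⁻ ⁅ x ⁆ p y∈⁅x⁆∩p in x∉p (subst (_∈ p) (x∈⁅y⁆⇒x≡y x y∈⁅x⁆) y∈p)
    ∩-vanishes : sumOver (⁅ x ⁆ ∩ p) f ≡ 0
    ∩-vanishes = trans (cong (λ q → sumOver q f) ⁅x⁆∩p≡⊥) (sumOver-⊥ f)

  fromList : List (Fin n) → Subset n
  fromList = foldr (λ x p → ⁅ x ⁆ ∪ p) ⊥

  ∈-fromList⁺ : ∀ {v : Fin n} {L} → v ∈ₗ L → v ∈ fromList L
  ∈-fromList⁺ {v = v} (here refl) = x∈p∪q⁺ (inj₁ (x∈⁅x⁆ v))
  ∈-fromList⁺ (there v∈L)         = x∈p∪q⁺ (inj₂ (∈-fromList⁺ v∈L))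

  ∈-fromList⁻ : ∀ {v : Fin n} L → v ∈ fromList L → v ∈ₗ L
  ∈-fromList⁻ []      v∈ = contradiction v∈ ∉⊥
  ∈-fromList⁻ (x ∷ L) v∈ with x∈p∪q⁻ ⁅ x ⁆ (fromList L) v∈
  ... | inj₁ v∈⁅x⁆ = here (x∈⁅y⁆⇒x≡y x v∈⁅x⁆)
  ... | inj₂ v∈L   = there (∈-fromList⁻ L v∈L)

  sumOver-fromList≤ : (L : List (Fin n)) (f : Fin n → ℕ) → sumOver (fromList L) f ≤ sum (map f L)
  sumOver-fromList≤ []      f = ≤-reflexive (sumOver-⊥ f)
  sumOver-fromList≤ (x ∷ L) f =
    ≤-trans (sumOver-⁅x⁆∪p≤ x (fromList L) f) (+-monoʳ-≤ (f x) (sumOver-fromList≤ L f))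

  sumOver-fromList : ∀ {L : List (Fin n)} (f : Fin n → ℕ) → Unique L → sumOver (fromList L) f ≡ sum (map f L)
  sumOver-fromList f []                        = sumOver-⊥ f
  sumOver-fromList {L = x ∷ L} f (x∉L ∷ L!) =
    trans (sumOver-⁅x⁆∪p f (All¬⇒¬Any x∉L ∘ ∈-fromList⁻ L)) (cong (f x +_) (sumOver-fromList f L!))

  sum-map-const1 : ∀ {A : Set} (L : List A) → sum (map (λ _ → 1) L) ≡ length L
  sum-map-const1 []      = refl
  sum-map-const1 (_ ∷ L) = cong suc (sum-map-const1 L)

  ∣fromList∣≡length : ∀ {L : List (Fin n)} → Unique L → ∣ fromList L ∣ ≡ length L
  ∣fromList∣≡length {L = L} L! =
    trans (∣p∣≡sumOver (fromList L)) (trans (sumOver-fromList _ L!) (sum-map-const1 L))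

  ∣fromList∣≤length : (L : List (Fin n)) → ∣ fromList L ∣ ≤ length L
  ∣fromList∣≤length L =
    subst₂ _≤_ (sym (∣p∣≡sumOver (fromList L))) (sum-map-const1 L) (sumOver-fromList≤ L _)

  length≤∣p∣ : ∀ {L : List (Fin n)} {p} → Unique L → All (_∈ p) L → length L ≤ ∣ p ∣
  length≤∣p∣ {L = L} L! L⊆p =
    subst (_≤ _) (∣fromList∣≡length L!) (p⊆q⇒∣p∣≤∣q∣ (All.lookup L⊆p ∘ ∈-fromList⁻ L))

  length≤n : ∀ {L : List (Fin n)} → Unique L → length L ≤ n
  length≤n {L = L} L! = subst (_≤ _) (∣fromList∣≡length L!) (∣p∣≤n (fromList L))

  pad : ∀ {p q : Subset n} m → p ⊆ q → ∣ p ∣ ≤ m → m ≤ ∣ q ∣ →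
        Σ (Subset n) λ r → p ⊆ r × r ⊆ q × ∣ r ∣ ≡ m
  pad {p = []} {[]} m _ _ m≤0 = [] , id , id , sym (n≤0⇒n≡0 m≤0)
  pad {p = inside ∷ p} {inside ∷ q} (suc m) p⊆q (s≤s ∣p∣≤m) (s≤s m≤∣q∣) =
    let r , p⊆r , r⊆q , ∣r∣≡m = pad m (drop-∷-⊆ p⊆q) ∣p∣≤m m≤∣q∣
    in  inside ∷ r , in⊆in p⊆r , in⊆in r⊆q , cong suc ∣r∣≡m
  pad {p = inside ∷ p} {outside ∷ q} m p⊆q _ _ with () ← p⊆q [zero]=
  pad {p = outside ∷ p} {outside ∷ q} m p⊆q ∣p∣≤m m≤∣q∣ =
    let r , p⊆r , r⊆q , ∣r∣≡m = pad m (drop-∷-⊆ p⊆q) ∣p∣≤m m≤∣q∣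
    in  outside ∷ r , out⊆ p⊆r , out⊆ r⊆q , ∣r∣≡m
  pad {p = outside ∷ p} {inside ∷ q} m p⊆q ∣p∣≤m m≤1+∣q∣ with m ≤? ∣ q ∣
  ... | yes m≤∣q∣ =
    let r , p⊆r , r⊆q , ∣r∣≡m = pad m (drop-∷-⊆ p⊆q) ∣p∣≤m m≤∣q∣
    in  outside ∷ r , out⊆ p⊆r , out⊆ r⊆q , ∣r∣≡m
  ... | no m≰∣q∣ = inside ∷ q , out⊆ (drop-∷-⊆ p⊆q) , id , ≤-antisym (≰⇒> m≰∣q∣) m≤1+∣q∣

module Matchings where

  open Lists
  open Subsets using (length≤∣p∣; length≤n)
  open import Data.Bool using (T)
  open import Data.Fin using (Fin)
  open import Data.Fin.Subset using (Subset; _∈_; _∉_; ∣_∣)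
  open import Data.Fin.Subset.Properties using (_∈?_)
  open import Data.List using (List; []; _∷_; map; length; filter; take)
  open import Data.List.Properties using (length-take)
  open import Data.List.Membership.Propositional using () renaming (_∈_ to _∈ₗ_; _∉_ to _∉ₗ_)
  open import Data.List.Relation.Unary.All as All using (All; _∷_)
  open import Data.List.Relation.Unary.All.Properties using (All¬⇒¬Any; ¬Any⇒All¬; all-filter)
    renaming (map⁺ to All-map⁺)
  open import Data.List.Relation.Unary.Any using (here; there; _─_)
  open import Data.List.Relation.Unary.Unique.Propositional using (Unique; _∷_)
  open import Data.List.Relation.Unary.Unique.Propositional.Properties using (filter⁺)
  open import Data.List.Relation.Binary.Sublist.Propositional using (_⊆_; []; _∷_; _∷ʳ_; ⊆-trans)
  open import Data.List.Relation.Binary.Sublist.Propositional.Properties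
    using (All-resp-⊆; take-⊆; filter-⊆)
  open import Data.List.Relation.Binary.Permutation.Propositional
    using (_↭_; refl; prep; swap; trans; ↭-sym)
  open import Data.List.Relation.Binary.Permutation.Propositional.Properties
    using (All-resp-↭; ∈-resp-↭; shifts; ++⁺ˡ)
  open import Data.Nat using (ℕ; suc; _+_; _*_; _∸_; _≤_; z≤n; s≤s)
  open import Data.Nat.ListAction using (sum)
  open import Data.Nat.Properties
    using (+-assoc; +-suc; ≤-trans; n≤1+n; m≤n⇒m⊓n≡m; m≤n+o⇒m∸n≤o; ∸-monoʳ-≤; module ≤-Reasoning)
  open import Data.Product using (Σ; ∃₂; _×_; _,_; proj₁; proj₂) renaming (swap to reverse)
  open import Data.Sum using (_⊎_; inj₁; inj₂)
  open import Function using (_∘_)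
  open import Relation.Binary.PropositionalEquality
    using (_≡_; _≢_; refl; sym; cong; subst) renaming (trans to ≡-trans)
  open import Relation.Nullary using (yes; no; contradiction)
  open import Relation.Nullary.Decidable using (_×-dec_; ¬?)
  open import Relation.Unary using (Decidable)

  private variable
    n : ℕ

  Edge : ℕ → Set
  Edge n = Fin n × Fin n

  IsEdge : Graph n → Edge n → Set
  IsEdge E (u , v) = T (E u v)

  IsMaximum : Graph n → List (Edge n) → Set
  IsMaximum E M = ∀ M′ → IsMatching E M′ → length M′ ≤ length M

  HasMatchingOfSize : Graph n → ℕ → Set
  HasMatchingOfSize {n} E k = Σ (List (Edge n)) λ M → IsMatching E M × length M ≡ k

  IsVertexCover : Graph n → Subset n → Set
  IsVertexCover E C = ∀ u v → T (E u v) → u ∈ C ⊎ v ∈ C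

  Avoids : Subset n → Edge n → Set
  Avoids C (u , v) = u ∉ C × v ∉ C

  IsReorientation : (Edge n → Edge n) → Set
  IsReorientation {n} f = ∀ (e : Edge n) → f e ≡ e ⊎ f e ≡ reverse e

  ∈-endpoints⁺ˡ : ∀ {u v : Fin n} {M} → (u , v) ∈ₗ M → u ∈ₗ endpoints M
  ∈-endpoints⁺ˡ (here refl) = here refl
  ∈-endpoints⁺ˡ (there e∈M) = there (there (∈-endpoints⁺ˡ e∈M))

  ∈-endpoints⁺ʳ : ∀ {u v : Fin n} {M} → (u , v) ∈ₗ M → v ∈ₗ endpoints M
  ∈-endpoints⁺ʳ (here refl) = there (here refl)
  ∈-endpoints⁺ʳ (there e∈M) = there (there (∈-endpoints⁺ʳ e∈M))

  ∈-endpoints⁻ : ∀ {x : Fin n} M → x ∈ₗ endpoints M → ∃₂ λ u v → (u , v) ∈ₗ M × (x ≡ u ⊎ x ≡ v)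
  ∈-endpoints⁻ ((u , v) ∷ M) (here x≡u)         = u , v , here refl , inj₁ x≡u
  ∈-endpoints⁻ ((u , v) ∷ M) (there (here x≡v)) = u , v , here refl , inj₂ x≡v
  ∈-endpoints⁻ (_ ∷ M) (there (there x∈M)) =
    let u , v , e∈M , x∈e = ∈-endpoints⁻ M x∈M in u , v , there e∈M , x∈e

  length-endpoints : (M : List (Edge n)) → length (endpoints M) ≡ 2 * length M
  length-endpoints []      = refl
  length-endpoints (_ ∷ M) = ≡-trans (cong (suc ∘ suc) (length-endpoints M)) (cong suc (sym (+-suc _ _)))

  sum-endpoints : (f : Fin n → ℕ) (M : List (Edge n)) →
    sum (map f (endpoints M)) ≡ sum (map (λ (u , v) → f u + f v) M)
  sum-endpoints f []            = refl
  sum-endpoints f ((u , v) ∷ M) =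
    ≡-trans (sym (+-assoc (f u) (f v) _)) (cong (f u + f v +_) (sum-endpoints f M))

  endpoints-⊆ : {M′ M : List (Edge n)} → M′ ⊆ M → endpoints M′ ⊆ endpoints M
  endpoints-⊆ []             = []
  endpoints-⊆ ((u , v) ∷ʳ τ) = u ∷ʳ v ∷ʳ endpoints-⊆ τ
  endpoints-⊆ (refl ∷ τ)     = refl ∷ refl ∷ endpoints-⊆ τ

  endpoints-↭ : {M M′ : List (Edge n)} → M ↭ M′ → endpoints M ↭ endpoints M′
  endpoints-↭ refl                     = refl
  endpoints-↭ (prep (u , v) σ)         = prep u (prep v (endpoints-↭ σ))
  endpoints-↭ (swap (u , v) (x , y) σ) =
    trans (shifts (u ∷ v ∷ []) (x ∷ y ∷ [])) (++⁺ˡ (x ∷ y ∷ u ∷ v ∷ []) (endpoints-↭ σ))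
  endpoints-↭ (trans σ τ)              = trans (endpoints-↭ σ) (endpoints-↭ τ)

  endpoints-reorient : ∀ {f : Edge n → Edge n} → IsReorientation f → ∀ M → endpoints (map f M) ↭ endpoints M
  endpoints-reorient f-reorients [] = refl
  endpoints-reorient {f = f} f-reorients ((u , v) ∷ M) with f (u , v) | f-reorients (u , v)
  ... | _ | inj₁ refl = prep u (prep v (endpoints-reorient f-reorients M))
  ... | _ | inj₂ refl = swap v u (endpoints-reorient f-reorients M)

  module _ {E : Graph n} where

    IsMatching-⊆ : ∀ {M′ M} → M′ ⊆ M → IsMatching E M → IsMatching E M′
    IsMatching-⊆ τ (edges , M!) = All-resp-⊆ τ edges , Unique-⊆ (endpoints-⊆ τ) M!

    IsMatching-↭ : ∀ {M M′} → M ↭ M′ → IsMatching E M → IsMatching E M′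
    IsMatching-↭ σ (edges , M!) = All-resp-↭ σ edges , Unique-↭ (endpoints-↭ σ) M!

    IsMatching-reorient : ∀ {E′ : Graph n} {f M} → IsReorientation f →
                          (∀ {e} → IsEdge E e → IsEdge E′ (f e)) → IsMatching E M → IsMatching E′ (map f M)
    IsMatching-reorient {M = M} f-reorients f-edge (edges , M!) =
      All-map⁺ (All.map f-edge edges) , Unique-↭ (↭-sym (endpoints-reorient f-reorients M)) M!

    IsMatching-∷ : ∀ {u v M} → T (E u v) → u ≢ v → u ∉ₗ endpoints M → v ∉ₗ endpoints M →
                   IsMatching E M → IsMatching E ((u , v) ∷ M)
    IsMatching-∷ e u≢v u∉M v∉M (edges , M!) =
      e ∷ edges , (u≢v ∷ ¬Any⇒All¬ _ u∉M) ∷ ¬Any⇒All¬ _ v∉M ∷ M!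

    IsMatching-∷⁻ : ∀ {u v M} → IsMatching E ((u , v) ∷ M) →
                    u ∉ₗ endpoints M × v ∉ₗ endpoints M × IsMatching E M
    IsMatching-∷⁻ (_ ∷ edges , (_ ∷ u∉M) ∷ v∉M ∷ M!) = All¬⇒¬Any u∉M , All¬⇒¬Any v∉M , edges , M!

    module _ {u v M} (M-match : IsMatching E M) (e∈M : (u , v) ∈ₗ M) where

      IsMatching-─ : u ∉ₗ endpoints (M ─ e∈M) × v ∉ₗ endpoints (M ─ e∈M) × IsMatching E (M ─ e∈M)
      IsMatching-─ = IsMatching-∷⁻ (IsMatching-↭ (↭-─ e∈M) M-match)

      ∈-endpoints-─ : ∀ {x} → x ∈ₗ endpoints (M ─ e∈M) → x ∈ₗ endpoints M
      ∈-endpoints-─ x∈ = ∈-resp-↭ (↭-sym (endpoints-↭ (↭-─ e∈M))) (there (there x∈))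

  mate-unique : ∀ {a a′ b : Fin n} {M} → Unique (endpoints M) → (a , b) ∈ₗ M → (a′ , b) ∈ₗ M → a ≡ a′
  mate-unique _ (here refl) (here refl) = refl
  mate-unique (_ ∷ b∉M ∷ _) (here refl) (there e∈M) = contradiction (∈-endpoints⁺ʳ e∈M) (All¬⇒¬Any b∉M)
  mate-unique (_ ∷ b∉M ∷ _) (there e∈M) (here refl) = contradiction (∈-endpoints⁺ʳ e∈M) (All¬⇒¬Any b∉M)
  mate-unique (_ ∷ _ ∷ M!)  (there e∈M) (there e′∈M) = mate-unique M! e∈M e′∈M

  2*size≤n : ∀ {E : Graph n} {k} → HasMatchingOfSize E k → 2 * k ≤ n
  2*size≤n {n} (M , (_ , M!) , refl) = subst (_≤ n) (length-endpoints M) (length≤n M!)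

  Avoids-endpoints : ∀ {C : Subset n} {M v} → All (Avoids C) M → v ∈ₗ endpoints M → v ∉ C
  Avoids-endpoints {M = M} avoids v∈M with ∈-endpoints⁻ M v∈M
  ... | _ , _ , e∈M , inj₁ refl = proj₁ (All.lookup avoids e∈M)
  ... | _ , _ , e∈M , inj₂ refl = proj₂ (All.lookup avoids e∈M)

  avoids? : (C : Subset n) → Decidable (Avoids C)
  avoids? C (u , v) = ¬? (u ∈? C) ×-dec ¬? (v ∈? C)

  length≤touched+avoiding : (C : Subset n) (M : List (Edge n)) →
    length M ≤ length (filter (_∈? C) (endpoints M)) + length (filter (avoids? C) M)
  length≤touched+avoiding C []            = z≤n
  length≤touched+avoiding C ((u , v) ∷ M) with u ∈? C
  ... | yes _ with v ∈? C
  ...   | yes _ = ≤-trans (s≤s (length≤touched+avoiding C M)) (n≤1+n _)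
  ...   | no  _ = s≤s (length≤touched+avoiding C M)
  length≤touched+avoiding C ((u , v) ∷ M) | no _ with v ∈? C
  ...   | yes _ = s≤s (length≤touched+avoiding C M)
  ...   | no  _ = subst (suc (length M) ≤_) (sym (+-suc _ _)) (s≤s (length≤touched+avoiding C M))

  avoiding-submatching : ∀ {E : Graph n} {M} {C : Subset n} {k} → IsMatching E M → ∣ C ∣ ≤ k →
    Σ (List (Edge n)) λ F → IsMatching E F × length F ≡ length M ∸ k × All (Avoids C) F
  avoiding-submatching {M = M} {C} {k} M-match@(_ , M!) ∣C∣≤k =
    take m avoiding ,
    IsMatching-⊆ (⊆-trans (take-⊆ m avoiding) (filter-⊆ (avoids? C) M)) M-match ,
    ≡-trans (length-take m avoiding) (m≤n⇒m⊓n≡m m≤avoiding) ,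
    All-resp-⊆ (take-⊆ m avoiding) (all-filter (avoids? C) M)
    where
    open ≤-Reasoning
    m = length M ∸ k
    avoiding = filter (avoids? C) M
    touched  = filter (_∈? C) (endpoints M)
    touched≤∣C∣ : length touched ≤ ∣ C ∣
    touched≤∣C∣ = length≤∣p∣ (filter⁺ (_∈? C) M!) (all-filter (_∈? C) (endpoints M))
    m≤avoiding : m ≤ length avoiding
    m≤avoiding = begin
      length M ∸ k                ≤⟨ ∸-monoʳ-≤ (length M) ∣C∣≤k ⟩
      length M ∸ ∣ C ∣            ≤⟨ ∸-monoʳ-≤ (length M) touched≤∣C∣ ⟩
      length M ∸ length touched   ≤⟨ m≤n+o⇒m∸n≤o (length M) (length touched) (length≤touched+avoiding C M) ⟩
      length avoiding             ∎

module König where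

  open Subsets using (fromList; ∈-fromList⁺; ∣fromList∣≤length)
  open Lists using (∈-─⁺; length-─)
  open Matchings
  open import Data.Bool using (Bool; true; false; T; not; _∧_; _∨_; if_then_else_)
  open import Data.Bool.Properties using (T?; T-≡; T-∧; T-∨; T-not-≡; ¬-not)
  open import Data.Fin using (Fin; zero; suc)
  open import Data.Fin.Properties using (all?) renaming (_≟_ to _≟ᶠ_)
  open import Data.Fin.Subset using (Subset; ∣_∣)
  open import Data.Fin.Subset.Properties using (_∈?_; anySubset?)
  open import Data.List using (List; _∷_; map; length)
  open import Data.List.Properties using (length-map)
  open import Data.List.Membership.Propositional using () renaming (_∈_ to _∈ₗ_; _∉_ to _∉ₗ_)
  open import Data.List.Membership.Propositional.Properties using (∈-map⁺)
  open import Data.List.Relation.Unary.All as All using ()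
  open import Data.List.Relation.Unary.Any using (here; there; _─_)
  open import Data.Nat using (ℕ; zero; suc; _≤_; _≤?_)
  open import Data.Nat.Properties using (1+n≰n)
  open import Data.Product using (Σ; ∃; _×_; _,_; proj₁; proj₂)
  open import Data.Sum using (_⊎_; inj₁; inj₂; [_,_]′) renaming (map to ⊎-map; swap to ⊎-swap)
  open import Effect.Monad using (RawMonad)
  open import Function using (_∘_; id)
  open import Function.Bundles using (module Equivalence)
  open import Level using (0ℓ)
  open import Relation.Binary.PropositionalEquality using (_≡_; _≢_; refl; sym; trans; cong; subst; subst₂)
  open import Relation.Nullary using (¬_; Dec; yes; no; does; contradiction)
  open import Relation.Nullary.Decidable
    using (decidable-stable; ¬¬-excluded-middle; dec-true; dec-false; _×-dec_; _⊎-dec_; _→-dec_)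
  open import Relation.Nullary.Negation using (¬¬-Monad; ¬¬-map)

  open RawMonad (¬¬-Monad {a = 0ℓ})

  private variable
    n : ℕ

  ¬¬-decidable : (P : Fin n → Set) → ¬ ¬ (∀ x → Dec (P x))
  ¬¬-decidable {zero}  P = pure λ ()
  ¬¬-decidable {suc n} P = do
    P₀? ← ¬¬-excluded-middle
    P₊? ← ¬¬-decidable (P ∘ suc)
    pure λ { zero → P₀? ; (suc x) → P₊? x }

  vertex-cover? : (E : Graph n) (k : ℕ) → Dec (Σ (Subset n) λ C → ∣ C ∣ ≤ k × IsVertexCover E C)
  vertex-cover? E k =
    anySubset? λ C → (∣ C ∣ ≤? k) ×-dec all? λ u → all? λ v → T? (E u v) →-dec (u ∈? C ⊎-dec v ∈? C)

  IsOriented : Graph n → (Fin n → Bool) → Set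
  IsOriented E side = ∀ {l r} → T (E l r) → side l ≡ false × side r ≡ true

  module Oriented {E : Graph n} {side : Fin n → Bool} (oriented : IsOriented E side) where

    open import Data.List.Membership.DecPropositional (_≟ᶠ_ {n}) using () renaming (_∈?_ to _∈ₗ?_)

    left≢right : ∀ {l r l′ r′} → T (E l r) → T (E l′ r′) → l ≢ r′
    left≢right e e′ l≡r′
      with () ← trans (sym (proj₁ (oriented e))) (trans (cong side l≡r′) (proj₂ (oriented e′)))

    right-mate : ∀ {M l r} → IsMatching E M → T (E l r) → r ∈ₗ endpoints M → ∃ λ l′ → (l′ , r) ∈ₗ M
    right-mate {M} (edges , _) e r∈M with ∈-endpoints⁻ M r∈M
    ... | a , _ , e′∈M , inj₁ refl = contradiction refl (left≢right (All.lookup edges e′∈M) e)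
    ... | a , _ , e′∈M , inj₂ refl = a , e′∈M

    left-mate : ∀ {M l r} → IsMatching E M → T (E l r) → l ∈ₗ endpoints M → ∃ λ r′ → (l , r′) ∈ₗ M
    left-mate {M} (edges , _) e l∈M with ∈-endpoints⁻ M l∈M
    ... | _ , b , e′∈M , inj₁ refl = b , e′∈M
    ... | _ , b , e′∈M , inj₂ refl = contradiction refl (left≢right e (All.lookup edges e′∈M))

    -- The index bounds the number of unmatched edges: augmenting along a path reroutes its tail,
    -- which is then no longer a structural subterm.
    data AugPath (M : List (Edge n)) : ℕ → Fin n → Set where
      unmatched-end : ∀ {k l r} → T (E l r) → r ∉ₗ endpoints M → AugPath M (suc k) l
      alternate     : ∀ {k l r l′} → T (E l r) → (l′ , r) ∈ₗ M → AugPath M k l′ → AugPath M (suc k) l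

    AugPath-suc : ∀ {M k l} → AugPath M k l → AugPath M (suc k) l
    AugPath-suc (unmatched-end e r∉M) = unmatched-end e r∉M
    AugPath-suc (alternate e p b)      = alternate e p (AugPath-suc b)

    module AugmentFirstEdge {M l r l′} (M-match : IsMatching E M) (e : T (E l r)) (l∉M : l ∉ₗ endpoints M)
                            (p : (l′ , r) ∈ₗ M) where

      M₁ : List (Edge n)
      M₁ = (l , r) ∷ (M ─ p)

      private
        l′∉M─p    = proj₁ (IsMatching-─ M-match p)
        r∉M─p     = proj₁ (proj₂ (IsMatching-─ M-match p))
        M─p-match = proj₂ (proj₂ (IsMatching-─ M-match p))

      M₁-match : IsMatching E M₁
      M₁-match = IsMatching-∷ e (left≢right e e) (l∉M ∘ ∈-endpoints-─ M-match p) r∉M─p M─p-match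

      l′∉M₁ : l′ ∉ₗ endpoints M₁
      l′∉M₁ (here refl)          = l∉M (∈-endpoints⁺ˡ p)
      l′∉M₁ (there (here l′≡r))  = left≢right (All.lookup (proj₁ M-match) p) e l′≡r
      l′∉M₁ (there (there l′∈)) = l′∉M─p l′∈

      -- A path that used the removed edge (l′ , r) is cut short at l′.
      reroute : ∀ {j x} → AugPath M j x → AugPath M₁ j x ⊎ AugPath M₁ j l′
      reroute (unmatched-end {r = r₀} e₀ r₀∉M) = inj₁ (unmatched-end e₀ r₀∉M₁)
        where
        r₀∉M₁ : r₀ ∉ₗ endpoints M₁
        r₀∉M₁ (here r₀≡l)          = left≢right e e₀ (sym r₀≡l)
        r₀∉M₁ (there (here refl))  = r₀∉M (∈-endpoints⁺ʳ p)
        r₀∉M₁ (there (there r₀∈)) = r₀∉M (∈-endpoints-─ M-match p r₀∈)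
      reroute (alternate {r = r₀} e₀ q b) with r₀ ≟ᶠ r
      ... | yes refl with refl ← mate-unique (proj₂ M-match) q p =
        inj₂ (AugPath-suc ([ id , id ]′ (reroute b)))
      ... | no r₀≢r =
        ⊎-map (alternate e₀ (there (∈-─⁺ p q (r₀≢r ∘ cong proj₂)))) AugPath-suc (reroute b)

    augment : ∀ k {M l} → IsMatching E M → l ∉ₗ endpoints M → AugPath M k l →
              Σ (List (Edge n)) λ M′ → IsMatching E M′ × length M′ ≡ suc (length M)
    augment (suc k) {M} {l} M-match l∉M (unmatched-end {r = r} e r∉M) =
      (l , r) ∷ M , IsMatching-∷ e (left≢right e e) l∉M r∉M M-match , refl
    augment (suc k) M-match l∉M (alternate e p b) =
      let M′ , M′-match , ∣M′∣ = augment k M₁-match l′∉M₁ ([ id , id ]′ (reroute b))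
      in  M′ , M′-match , trans ∣M′∣ (cong suc (sym (length-─ p)))
      where open AugmentFirstEdge M-match e l∉M p

    data Reachable (M : List (Edge n)) : Fin n → Set where
      unmatched : ∀ {l} → l ∉ₗ endpoints M → Reachable M l
      via       : ∀ {l₀ r l} → Reachable M l₀ → T (E l₀ r) → (l , r) ∈ₗ M → Reachable M l

    HasReachableNeighbour : List (Edge n) → Fin n → Set
    HasReachableNeighbour M r = ∃ λ l₀ → Reachable M l₀ × T (E l₀ r)

    module _ {M} (M-match : IsMatching E M) (M-max : IsMaximum E M) where

      no-augpath : ∀ {k l} → Reachable M l → ¬ AugPath M k l
      no-augpath (unmatched l∉M) b =
        let M′ , M′-match , ∣M′∣ = augment _ M-match l∉M b
        in  1+n≰n (subst (_≤ length M) ∣M′∣ (M-max M′ M′-match))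
      no-augpath (via z e p) b = no-augpath z (alternate e p b)

      module _ (neighbour? : ∀ r → Dec (HasReachableNeighbour M r)) where

        pick : Edge n → Fin n
        pick (l , r) = if does (neighbour? r) then r else l

        cover : List (Fin n)
        cover = map pick M

        right∈cover : ∀ {l r} → (l , r) ∈ₗ M → HasReachableNeighbour M r → r ∈ₗ cover
        right∈cover {l} {r} p N =
          subst (_∈ₗ cover) (cong (λ b → if b then r else l) (dec-true (neighbour? r) N)) (∈-map⁺ pick p)

        left∈cover : ∀ {l r} → (l , r) ∈ₗ M → ¬ HasReachableNeighbour M r → l ∈ₗ cover
        left∈cover {l} {r} p ¬N =
          subst (_∈ₗ cover) (cong (λ b → if b then r else l) (dec-false (neighbour? r) ¬N)) (∈-map⁺ pick p)

        cover-covers : (∀ l → Dec (Reachable M l)) → ∀ l r → T (E l r) → l ∈ₗ cover ⊎ r ∈ₗ cover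
        cover-covers reachable? l r e with reachable? l
        ... | yes z with r ∈ₗ? endpoints M
        ...   | no r∉M  = contradiction (unmatched-end {k = 0} e r∉M) (no-augpath z)
        ...   | yes r∈M = inj₂ (right∈cover (proj₂ (right-mate M-match e r∈M)) (l , z , e))
        cover-covers reachable? l r e | no ¬z with l ∈ₗ? endpoints M
        ...   | no l∉M  = contradiction (unmatched l∉M) ¬z
        ...   | yes l∈M =
          let _ , p = left-mate M-match e l∈M in inj₁ (left∈cover p λ (_ , z₀ , e₀) → ¬z (via z₀ e₀ p))

      ¬¬-cover : ¬ ¬ (Σ (List (Fin n)) λ C → length C ≡ length M × (∀ l r → T (E l r) → l ∈ₗ C ⊎ r ∈ₗ C))
      ¬¬-cover = do
        reachable? ← ¬¬-decidable (Reachable M)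
        neighbour? ← ¬¬-decidable (HasReachableNeighbour M)
        pure (cover neighbour? , length-map (pick neighbour?) M , cover-covers neighbour? reachable?)

      -- Reachability is not decidable by construction, so the cover above only exists under double
      -- negation; but having a vertex cover of a given size is decidable, hence stable.
      vertex-cover : Σ (Subset n) λ C → ∣ C ∣ ≤ length M × IsVertexCover E C
      vertex-cover = decidable-stable (vertex-cover? E (length M)) (¬¬-map as-subset ¬¬-cover)
        where
        as-subset : (Σ (List (Fin n)) λ C → length C ≡ length M × (∀ l r → T (E l r) → l ∈ₗ C ⊎ r ∈ₗ C)) →
                    Σ (Subset n) λ C → ∣ C ∣ ≤ length M × IsVertexCover E C
        as-subset (C , ∣C∣ , covers) =
          fromList C , subst (∣ fromList C ∣ ≤_) ∣C∣ (∣fromList∣≤length C) ,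
          λ u v e → ⊎-map ∈-fromList⁺ ∈-fromList⁺ (covers u v e)

  IsProperColouring : Graph n → (Fin n → Bool) → Set
  IsProperColouring H c = ∀ u v → T (H u v) → c u ≢ c v

  -- H need not be symmetric: every edge of H, in either direction, becomes an edge from colour false to true.
  orient : Graph n → (Fin n → Bool) → Graph n
  orient H c l r = not (c l) ∧ (H l r ∨ H r l)

  module _ {H : Graph n} {c : Fin n → Bool} (proper : IsProperColouring H c) where

    colour-flip : ∀ {u v} → T (H u v) → c v ≡ not (c u)
    colour-flip {u} {v} h = ¬-not (proper u v h ∘ sym)

    orient-isOriented : IsOriented (orient H c) c
    orient-isOriented {l} {r} e = cl≡false , trans (¬-not cr≢cl) (cong not cl≡false)
      where
      cl≡false = Equivalence.to T-not-≡ (proj₁ (Equivalence.to T-∧ e))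
      cr≢cl : c r ≢ c l
      cr≢cl = [ (λ h → proper l r h ∘ sym) , proper r l ]′ (Equivalence.to T-∨ (proj₂ (Equivalence.to T-∧ e)))

    orient-edge : ∀ {u v} → c u ≡ false → T (H u v) ⊎ T (H v u) → T (orient H c u v)
    orient-edge cu≡false h = Equivalence.from T-∧ (Equivalence.from T-not-≡ cu≡false , Equivalence.from T-∨ h)

    orient-cover : ∀ {C} → IsVertexCover (orient H c) C → IsVertexCover H C
    orient-cover cover u v h with c u in cu
    ... | false = cover u v (orient-edge cu (inj₁ h))
    ... | true  = ⊎-swap (cover v u (orient-edge (trans (colour-flip h) (cong not cu)) (inj₂ h)))

    toOriented : Edge n → Edge n
    toOriented (u , v) = if c u then (v , u) else (u , v)

    toOriented-reorients : IsReorientation toOriented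
    toOriented-reorients (u , v) with c u
    ... | true  = inj₂ refl
    ... | false = inj₁ refl

    toOriented-edge : ∀ {e} → IsEdge H e → IsEdge (orient H c) (toOriented e)
    toOriented-edge {u , v} h with c u in cu
    ... | true  = orient-edge (trans (colour-flip h) (cong not cu)) (inj₂ h)
    ... | false = orient-edge cu (inj₁ h)

    fromOriented : Edge n → Edge n
    fromOriented (l , r) = if H l r then (l , r) else (r , l)

    fromOriented-reorients : IsReorientation fromOriented
    fromOriented-reorients (l , r) with H l r
    ... | true  = inj₁ refl
    ... | false = inj₂ refl

    fromOriented-edge : ∀ {e} → IsEdge (orient H c) e → IsEdge H (fromOriented e)
    fromOriented-edge {l , r} e with H l r in h
    ... | true  = Equivalence.from T-≡ h
    ... | false = proj₂ (Equivalence.to (T-∧ {not (c l)}) e)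

    bipartite-vertex-cover : ∀ {μ} → IsMaxMatchingSize H μ → Σ (Subset n) λ C → ∣ C ∣ ≤ μ × IsVertexCover H C
    bipartite-vertex-cover ((M₀ , M₀-match , ∣M₀∣≡μ) , M₀-max) =
      let C , ∣C∣≤∣M∣ , cover = Oriented.vertex-cover orient-isOriented M-match M-max
      in  C , subst (∣ C ∣ ≤_) ∣M∣≡μ ∣C∣≤∣M∣ , orient-cover cover
      where
      M = map toOriented M₀
      ∣M∣≡μ = trans (length-map toOriented M₀) ∣M₀∣≡μ
      M-match = IsMatching-reorient toOriented-reorients toOriented-edge M₀-match
      M-max : IsMaximum (orient H c) M
      M-max M′ M′-match = subst₂ _≤_ (length-map fromOriented M′) (sym ∣M∣≡μ)
        (M₀-max _ (IsMatching-reorient fromOriented-reorients fromOriented-edge M′-match))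

module Arithmetic where

  open import Data.Integer using (+_) renaming (_+_ to _+ℤ_; _*_ to _*ℤ_)
  open import Data.Integer.Properties using () renaming (*-identityʳ to ℤ-*-identityʳ)
  open import Data.List using (_∷_; map; length)
  open import Data.List.Relation.Unary.All using (All; []; _∷_)
  open import Data.Nat using (ℕ) renaming (_+_ to _+ℕ_; _*_ to _*ℕ_)
  open import Data.Nat.Coprimality using (1-coprimeTo) renaming (sym to coprime-sym)
  open import Data.Nat.ListAction using (sum)
  open import Data.Nat.Properties using (+-identityʳ)
  open import Data.Rational using (ℚ; mkℚ; _/_; _+_; _*_; _≤_; 1ℚ; ½)
  open import Data.Rational.Properties
    using (normalize-coprime; *-zeroˡ; *-identityˡ; *-identityʳ; *-distribʳ-+; +-mono-≤; ≤-reflexive;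
           module ≤-Reasoning)
  open import Data.Rational.Solver using (module +-*-Solver)
  open import Relation.Binary.PropositionalEquality
    using (_≡_; refl; sym; cong; cong₂; module ≡-Reasoning)

  ℕtoℚ-+ : ∀ a b → ℕtoℚ (a +ℕ b) ≡ ℕtoℚ a + ℕtoℚ b
  ℕtoℚ-+ a b = begin
    ℕtoℚ (a +ℕ b)                    ≡⟨ cong (_/ 1) (cong₂ _+ℤ_ (times-1 a) (times-1 b)) ⟩
    (+ a *ℤ + 1 +ℤ + b *ℤ + 1) / 1   ≡⟨⟩
    reduced a + reduced b            ≡⟨ sym (cong₂ _+_ (reduced≡ a) (reduced≡ b)) ⟩
    ℕtoℚ a + ℕtoℚ b                  ∎
    where
    open ≡-Reasoning
    times-1 : ∀ k → + k ≡ + k *ℤ + 1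
    times-1 k = sym (ℤ-*-identityʳ (+ k))
    reduced : ℕ → ℚ
    reduced k = mkℚ (+ k) 0 (coprime-sym (1-coprimeTo k))
    reduced≡ : ∀ k → ℕtoℚ k ≡ reduced k
    reduced≡ k = normalize-coprime (coprime-sym (1-coprimeTo k))

  length*≤sum : ∀ {A : Set} (w : A → ℕ) {x : ℚ} {xs} → All (λ a → x ≤ ℕtoℚ (w a)) xs →
    ℕtoℚ (length xs) * x ≤ ℕtoℚ (sum (map w xs))
  length*≤sum w {x} []                  = ≤-reflexive (*-zeroˡ x)
  length*≤sum w {x} {a ∷ xs} (x≤ ∷ xs≤) = begin
    ℕtoℚ (1 +ℕ length xs) * x             ≡⟨ cong (_* x) (ℕtoℚ-+ 1 (length xs)) ⟩
    (1ℚ + ℕtoℚ (length xs)) * x           ≡⟨ *-distribʳ-+ x 1ℚ (ℕtoℚ (length xs)) ⟩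
    1ℚ * x + ℕtoℚ (length xs) * x         ≡⟨ cong (_+ ℕtoℚ (length xs) * x) (*-identityˡ x) ⟩
    x + ℕtoℚ (length xs) * x              ≤⟨ +-mono-≤ x≤ (length*≤sum w xs≤) ⟩
    ℕtoℚ (w a) + ℕtoℚ (sum (map w xs))    ≡⟨ sym (ℕtoℚ-+ (w a) _) ⟩
    ℕtoℚ (w a +ℕ sum (map w xs))          ∎
    where open ≤-Reasoning

  twice*½ : ∀ k x → ℕtoℚ (2 *ℕ k) * x * ½ ≡ ℕtoℚ k * x
  twice*½ k x = begin
    ℕtoℚ (k +ℕ (k +ℕ 0)) * x * ½   ≡⟨ cong (λ m → ℕtoℚ (k +ℕ m) * x * ½) (+-identityʳ k) ⟩
    ℕtoℚ (k +ℕ k) * x * ½          ≡⟨ cong (λ q → q * x * ½) (ℕtoℚ-+ k k) ⟩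
    (ℕtoℚ k + ℕtoℚ k) * x * ½      ≡⟨ halve (ℕtoℚ k) x ½ ⟩
    ℕtoℚ k * x * ((1ℚ + 1ℚ) * ½)   ≡⟨ *-identityʳ _ ⟩
    ℕtoℚ k * x                     ∎
    where
    open ≡-Reasoning
    open +-*-Solver
    halve : ∀ q x h → (q + q) * x * h ≡ q * x * ((1ℚ + 1ℚ) * h)
    halve = solve 3 (λ q x h → (q :+ q) :* x :* h := q :* x :* ((con 1ℚ :+ con 1ℚ) :* h)) refl

module Witnesses where

  open Subsets using (fromList; ∈-fromList⁻; ∣fromList∣≡length; sumOver; sumOver-fromList; degSum≡sumOver)
  open Matchings
  open Arithmetic using (length*≤sum; twice*½)
  open import Data.Bool using (T)
  open import Data.Fin.Subset using (Subset; _⊆_; ∣_∣; ∁)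
  open import Data.Fin.Subset.Properties using (x∉p⇒x∈∁p; ∣∁p∣≡n∸∣p∣)
  open import Data.List using (map; length)
  open import Data.List.Relation.Unary.All as All using ()
  open import Data.Nat using (ℕ; _+_; _*_; _∸_; _≤_; z≤n)
  open import Data.Nat.ListAction using (sum)
  open import Data.Nat.Properties
    using (≤-total; ≤-trans; +-assoc; +-monoʳ-≤; +-monoˡ-≤; m+[n∸m]≡n; m∸n≤m; m≤n⇒m∸n≡0; m+n≤o⇒m≤o∸n;
           module ≤-Reasoning)
  open import Data.Product using (Σ; _×_; _,_)
  open import Data.Rational using (ℚ; ½) renaming (_≤_ to _≤ℚ_; _*_ to _*ℚ_)
  import Data.Rational.Properties as ℚ
  open import Data.Sum using (inj₁; inj₂; [_,_]′)
  open import Relation.Binary.PropositionalEquality using (_≡_; sym; trans; cong; subst)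
  open import Relation.Nullary using (¬_)

  private variable
    n : ℕ

  b+2[a∸b]≤n : ∀ {a b n} → 2 * a ≤ n → 2 * b ≤ n → b + 2 * (a ∸ b) ≤ n
  b+2[a∸b]≤n {a} {b} 2a≤n 2b≤n with ≤-total b a
  ... | inj₁ b≤a = ≤-trans (begin
    b + (a ∸ b + (a ∸ b + 0))  ≡⟨ sym (+-assoc b (a ∸ b) _) ⟩
    b + (a ∸ b) + (a ∸ b + 0)  ≡⟨ cong (_+ (a ∸ b + 0)) (m+[n∸m]≡n b≤a) ⟩
    a + (a ∸ b + 0)            ≤⟨ +-monoʳ-≤ a (+-monoˡ-≤ 0 (m∸n≤m a b)) ⟩
    2 * a                      ∎) 2a≤n
    where open ≤-Reasoning
  ... | inj₂ a≤b rewrite m≤n⇒m∸n≡0 a≤b = ≤-trans (+-monoʳ-≤ b z≤n) 2b≤n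

  room-outside : ∀ {μG μH} {S : Subset n} → 2 * μG ≤ n → 2 * μH ≤ n → ∣ S ∣ ≡ 2 * (μG ∸ μH) → μH ≤ ∣ ∁ S ∣
  room-outside {n} {μG} {μH} {S} 2μG≤n 2μH≤n ∣S∣≡ =
    subst (μH ≤_) (sym (∣∁p∣≡n∸∣p∣ S))
      (m+n≤o⇒m≤o∸n μH (subst (λ s → μH + s ≤ n) (sym ∣S∣≡) (b+2[a∸b]≤n {μG} {μH} 2μG≤n 2μH≤n)))

  module _ {G H : Graph n} {β⁻ : ℚ}
           (unused-heavy : ∀ u v → T (G u v) → ¬ T (H u v) → β⁻ ≤ℚ ℕtoℚ (deg H u + deg H v))
           {C : Subset n} (C-covers : IsVertexCover H C) where

    edge-degree : Edge n → ℕ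
    edge-degree (u , v) = deg H u + deg H v

    avoiding-edge-heavy : ∀ {e} → IsEdge G e × Avoids C e → β⁻ ≤ℚ ℕtoℚ (edge-degree e)
    avoiding-edge-heavy {u , v} (g , u∉C , v∉C) = unused-heavy u v g λ h → [ u∉C , v∉C ]′ (C-covers u v h)

    heavy-set : ∀ {μ k} → HasMatchingOfSize G μ → ∣ C ∣ ≤ k →
      Σ (Subset n) λ S → ∣ S ∣ ≡ 2 * (μ ∸ k) × C ⊆ ∁ S × ℕtoℚ ∣ S ∣ *ℚ β⁻ *ℚ ½ ≤ℚ ℕtoℚ (degSum H S)
    heavy-set {μ} {k} (M , M-match , ∣M∣≡μ) ∣C∣≤k =
      let F , (F-edges , F!) , ∣F∣≡ , F-avoids = avoiding-submatching M-match ∣C∣≤k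
          F-heavy = All.zipWith avoiding-edge-heavy (F-edges , F-avoids)
          S = fromList (endpoints F)
          ∣S∣≡2∣F∣ = trans (∣fromList∣≡length F!) (length-endpoints F)
      in  S , trans ∣S∣≡2∣F∣ (cong (2 *_) (trans ∣F∣≡ (cong (_∸ k) ∣M∣≡μ))) ,
          (λ v∈C → x∉p⇒x∈∁p λ v∈S → Avoids-endpoints F-avoids (∈-fromList⁻ _ v∈S) v∈C) ,
          (begin
            ℕtoℚ ∣ S ∣ *ℚ β⁻ *ℚ ½                   ≡⟨ cong (λ s → ℕtoℚ s *ℚ β⁻ *ℚ ½) ∣S∣≡2∣F∣ ⟩
            ℕtoℚ (2 * length F) *ℚ β⁻ *ℚ ½          ≡⟨ twice*½ (length F) β⁻ ⟩
            ℕtoℚ (length F) *ℚ β⁻                   ≤⟨ length*≤sum edge-degree F-heavy ⟩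
            ℕtoℚ (sum (map edge-degree F))          ≡⟨ cong ℕtoℚ (sym (sum-endpoints (deg H) F)) ⟩
            ℕtoℚ (sum (map (deg H) (endpoints F)))  ≡⟨ cong ℕtoℚ (sym (sumOver-fromList (deg H) F!)) ⟩
            ℕtoℚ (sumOver S (deg H))                ≡⟨ cong ℕtoℚ (sym (degSum≡sumOver H S)) ⟩
            ℕtoℚ (degSum H S)                       ∎)
      where open ℚ.≤-Reasoning

open Subsets using (pad)
open Matchings using (2*size≤n)
open König using (bipartite-vertex-cover)
open Witnesses using (heavy-set; room-outside)

open import Data.Bool using (T)
open import Data.Nat using (ℕ; _∸_) renaming (_*_ to _*ℕ_)
open import Data.Fin.Subset using (Subset; _∈_; ∣_∣)
open import Data.Product using (Σ; _×_)
open import Relation.Binary.PropositionalEquality using (_≡_)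
open import Data.Rational using (ℚ; _<_; _≤_; _*_; _-_; 0ℚ; 1ℚ; ½)

open import Data.Fin.Subset.Properties using (x∈∁p⇒x∉p)
open import Data.Product using (_,_)
open import Data.Sum using ([_,_]′)
open import Function using (_∘_)
open import Relation.Nullary using (contradiction)

lemma2 : {n : ℕ} (G H : Graph n) (β λ' : ℚ) (μG μH : ℕ)
    → IsSimpleGraph G → IsBipartite G
    → 0ℚ < λ' → λ' < 1ℚ
    → IsEDCS G H β (β * (1ℚ - λ'))
    → IsMaxMatchingSize G μG → IsMaxMatchingSize H μH
    → Σ (Subset n) λ S → Σ (Subset n) λ T' →
        Disjoint S T'
        × ∣ T' ∣ ≡ μH
        × ∣ S ∣ ≡ 2 *ℕ (μG ∸ μH)
        × (∀ s t → s ∈ S → T (H s t) → t ∈ T')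
        × ℕtoℚ ∣ S ∣ * (β * (1ℚ - λ')) * ½ ≤ ℕtoℚ (degSum H S)
lemma2 G H β λ' μG μH _ (c , proper) _ _ (H⊆G , _ , unused-heavy) (G-matching , _) H-max@(H-matching , _) =
  let C , ∣C∣≤μH , C-covers = bipartite-vertex-cover (λ u v → proper u v ∘ H⊆G u v) H-max
      S , ∣S∣≡2m , C⊆∁S , S-heavy = heavy-set unused-heavy C-covers G-matching ∣C∣≤μH
      T′ , C⊆T′ , T′⊆∁S , ∣T′∣≡μH =
        pad μH C⊆∁S ∣C∣≤μH (room-outside {S = S} (2*size≤n G-matching) (2*size≤n H-matching) ∣S∣≡2m)
  in  S , T′ ,
      (λ v v∈S v∈T′ → x∈∁p⇒x∉p (T′⊆∁S v∈T′) v∈S) ,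
      ∣T′∣≡μH ,
      ∣S∣≡2m ,
      (λ s t s∈S h → [ (λ s∈C → contradiction s∈S (x∈∁p⇒x∉p (C⊆∁S s∈C))) , C⊆T′ ]′ (C-covers s t h)) ,
      S-heavy
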